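{- Let $d\ge 2$, $n\ge d$ and $k\ge 1$ be integers with $\sum_{j=0}^k d^j \mid n$. If there is a vertex $x\in\{0,\dots,n-1\}$ of $G_B(n,d)$ satisfying $$(d-1)x\equiv n\Big/\sum_{j=0}^k d^j \pmod n,$$ then $\gamma_k(G_B(n,d)) = n/\sum_{j=0}^k d^j$, and $D=\{x,x+1,\dots,x+n/\sum_{j=0}^k d^j-1\}$ (taken modulo $n$) is a minimum distance $k$-dominating set of $G_B(n,d)$.
   Context: The generalized de Bruijn digraph $G_B(n,d)$ has vertex set $\{0,1,\dots,n-1\}$ and an arc $(x,y)$ whenever $y\equiv dx+i \pmod n$ for some $0\le i\le d-1$ (self-loops allowed). A set $D\subseteq V(G)$ of a digraph $G$ is a distance $k$-dominating set if every vertex $v\notin D$ has some $u\in D$ with a directed path from $u$ to $v$ of length at most $k$. $\gamma_k(G)$ denotes the minimum cardinality of a distance $k$-dominating set of $G$. -}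

module Defs where

open import Data.Nat using (ℕ; zero; suc; _+_; _*_; _∸_; _^_; _≤_; _<_; NonZero; nonZero)
open import Data.Nat.DivMod using (_%_; _/_)
open import Data.Fin using (Fin; toℕ)
open import Data.Fin.Subset using (Subset; _∈_; _∉_)
open import Data.Product using (Σ; ∃; ∃-syntax; _×_; _,_)
open import Data.Sum using (_⊎_)
open import Relation.Binary.PropositionalEquality using (_≡_)

-- Σ_{j=0}^{k} d^j, computed in Horner form: 1 + d (1 + d (... )),
-- so that it is definitionally a successor (NonZero instance is automatic).
geomSum : ℕ → ℕ → ℕ
geomSum d zero    = 1
geomSum d (suc k) = 1 + d * geomSum d k

Arc : (n d : ℕ) → .{{_ : NonZero n}} → Fin n → Fin n → Set
Arc n d x y = ∃[ i ] (i < d × (d * toℕ x + i) % n ≡ toℕ y)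

data Walk (n d : ℕ) .{{_ : NonZero n}} : ℕ → Fin n → Fin n → Set where
  here : ∀ {u} → Walk n d 0 u u
  step : ∀ {m u w v} → Arc n d u w → Walk n d m w v → Walk n d (suc m) u v

IsDistDom : (n d k : ℕ) → .{{_ : NonZero n}} → Subset n → Set
IsDistDom n d k D =
  ∀ (v : Fin n) → v ∉ D → ∃[ u ] (u ∈ D × ∃[ m ] (m ≤ k × Walk n d m u v))

geomSum-nonZero : ∀ d k → NonZero (geomSum d k)
geomSum-nonZero d zero    = _
geomSum-nonZero d (suc k) = _

quot : (n d k : ℕ) → ℕ
quot n d k = _/_ n (geomSum d k) {{geomSum-nonZero d k}}

module Submission where

-- A vertex has at most d successors, so at most 1 + d + ⋯ + d^k vertices lie within distance k of
-- it, and a distance-k dominating set has at least q = n / (1 + d + ⋯ + d^k) elements. Conversely,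
-- (d - 1) x ≡ q gives d^m x ≡ x + (1 + d + ⋯ + d^(m-1)) q, so a walk of length m from x + j ends at
-- x + r with r = (1 + d + ⋯ + d^(m-1)) q + d^m j + i for any chosen i < d^m. As m ≤ k, j < q and
-- i < d^m vary, r takes every value below (1 + d + ⋯ + d^k) q = n, so x, x + 1, …, x + q - 1 dominate.

open import Defs
open import Data.Nat using (ℕ; zero; suc; _+_; _*_; _∸_; _^_; _≤_; _<_; NonZero; z≤n; s≤s; _<?_)
open import Data.Nat.Properties
open import Data.Nat.DivMod
  using (_%_; _/_; _mod_; %-congˡ; %-distribˡ-+; %-distribˡ-*; m%n%n≡m%n; [m+n]%n≡m%n; m<n⇒m%n≡m;
         m%n<n; m≡m%n+[m/n]*n; m<n*o⇒m/o<n; m*[n/m]≡n)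
open import Data.Nat.Divisibility using (_∣_)
open import Data.Nat.Tactic.RingSolver using (solve-∀)
open import Data.Fin using (Fin; toℕ)
import Data.Fin as Fin
open import Data.Fin.Properties using (toℕ-fromℕ<; toℕ-injective; toℕ<n)
open import Data.Fin.Subset using (Subset; inside; outside; _∈_; _∪_; ⁅_⁆; ⋃; ⊤; ∣_∣)
open import Data.Fin.Subset.Properties
  using (x∈p∪q⁺; x∈p∪q⁻; x∈⁅x⁆; x∈⁅y⁆⇒x≡y; ∉⊥; ∣⊥∣≡0; ∣⁅x⁆∣≡1; p⊆q⇒∣p∣≤∣q∣; ∣p∣≤∣x∷p∣; ∣⊤∣≡n; _∈?_)
open import Data.Vec using ([]; _∷_; here; there)
open import Data.List using (List; []; _∷_; map; length; concatMap; upTo)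
open import Data.List.Properties using (length-map; length-++; length-upTo)
open import Data.List.Membership.Propositional using (lose) renaming (_∈_ to _∈ₗ_)
open import Data.List.Membership.Propositional.Properties using (∈-map⁺; ∈-map⁻; ∈-upTo⁺; ∈-upTo⁻; ∈-concatMap⁺)
open import Data.List.Relation.Unary.Any using () renaming (here to lhere; there to lthere)
open import Data.Product using (∃-syntax; _×_; _,_)
open import Data.Sum using (inj₁; inj₂)
open import Data.Empty using (⊥-elim)
open import Function.Base using (_∘_)
open import Function.Bundles using (_⇔_; mk⇔)
open import Relation.Nullary using (yes; no)
open import Relation.Binary.PropositionalEquality
  using (_≡_; refl; sym; trans; cong; cong₂; subst; module ≡-Reasoning)

repunit : ℕ → ℕ → ℕ
repunit d zero    = 0
repunit d (suc m) = 1 + d * repunit d m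

repunit-suc : ∀ d m → repunit d (suc m) ≡ repunit d m + d ^ m
repunit-suc d zero    = cong suc (*-zeroʳ d)
repunit-suc d (suc m) = trans (cong (λ t → 1 + d * t) (repunit-suc d m)) (distrib d (repunit d m) (d ^ m))
  where
  distrib : ∀ d r e → 1 + d * (r + e) ≡ 1 + d * r + d * e
  distrib = solve-∀

geomSum≡repunit : ∀ d k → geomSum d k ≡ repunit d (suc k)
geomSum≡repunit d zero    = cong suc (sym (*-zeroʳ d))
geomSum≡repunit d (suc k) = cong (λ t → 1 + d * t) (geomSum≡repunit d k)

bracket : ∀ (f : ℕ → ℕ) {r} K → f 0 ≤ r → r < f (suc K) → ∃[ m ] (m ≤ K × f m ≤ r × r < f (suc m))
bracket f zero    f0≤r r<f1 = 0 , z≤n , f0≤r , r<f1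
bracket f {r} (suc K) f0≤r r<fK+2 with r <? f (suc K)
... | yes r<fK+1 = let m , m≤K , below = bracket f K f0≤r r<fK+1 in m , m≤n⇒m≤1+n m≤K , below
... | no r≮fK+1  = suc K , ≤-refl , ≮⇒≥ r≮fK+1 , r<fK+2

<*⇒quotient-remainder : ∀ e .{{_ : NonZero e}} {q s} → s < e * q →
  ∃[ j ] (j < q × ∃[ i ] (i < e × e * j + i ≡ s))
<*⇒quotient-remainder e {q} {s} s<eq =
  s / e , m<n*o⇒m/o<n (subst (s <_) (*-comm e q) s<eq) , s % e , m%n<n s e , s≡
  where
  s≡ : e * (s / e) + s % e ≡ s
  s≡ = trans (+-comm (e * (s / e)) (s % e))
       (trans (cong (s % e +_) (*-comm e (s / e))) (sym (m≡m%n+[m/n]*n s e)))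

m≤n<m+o⇒n∸m<o : ∀ {m n o} → m ≤ n → n < m + o → n ∸ m < o
m≤n<m+o⇒n∸m<o {m} {n} {o} m≤n n<m+o = subst (n ∸ m <_) (m+n∸m≡n m o) (∸-monoˡ-< n<m+o m≤n)

repunit-suc-* : ∀ d m q → repunit d (suc m) * q ≡ repunit d m * q + d ^ m * q
repunit-suc-* d m q = trans (cong (_* q) (repunit-suc d m)) (*-distribʳ-+ q (repunit d m) (d ^ m))

repunit-decomposition : ∀ d .{{_ : NonZero d}} q k {r} → r < repunit d (suc k) * q →
  ∃[ m ] (m ≤ k × ∃[ j ] (j < q × ∃[ i ] (i < d ^ m × repunit d m * q + (d ^ m * j + i) ≡ r)))
repunit-decomposition d q k {r} r< with bracket (λ m → repunit d m * q) k z≤n r<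
... | m , m≤k , lo , hi
  with <*⇒quotient-remainder (d ^ m) {{m^n≢0 d m}} (m≤n<m+o⇒n∸m<o lo (subst (r <_) (repunit-suc-* d m q) hi))
... | j , j<q , i , i<dᵐ , ≡s = m , m≤k , j , j<q , i , i<dᵐ , trans (cong (repunit d m * q +_) ≡s) (m+[n∸m]≡n lo)

length-concatMap : ∀ {a b} {A : Set a} {B : Set b} (f : A → List B) {c} →
  (∀ x → length (f x) ≡ c) → ∀ xs → length (concatMap f xs) ≡ length xs * c
length-concatMap f f≡c []       = refl
length-concatMap f f≡c (x ∷ xs) =
  trans (length-++ (f x)) (cong₂ _+_ (f≡c x) (length-concatMap f f≡c xs))

module Modular (n : ℕ) .{{_ : NonZero n}} where

  %-cong-+ : ∀ {a b c e} → a % n ≡ b % n → c % n ≡ e % n → (a + c) % n ≡ (b + e) % n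
  %-cong-+ {a} {b} {c} {e} a≡b c≡e = begin
    (a + c) % n             ≡⟨ %-distribˡ-+ a c n ⟩
    (a % n + c % n) % n     ≡⟨ cong₂ (λ s t → (s + t) % n) a≡b c≡e ⟩
    (b % n + e % n) % n     ≡⟨ %-distribˡ-+ b e n ⟨
    (b + e) % n             ∎
    where open ≡-Reasoning

  %-cong-* : ∀ {a b c e} → a % n ≡ b % n → c % n ≡ e % n → (a * c) % n ≡ (b * e) % n
  %-cong-* {a} {b} {c} {e} a≡b c≡e = begin
    (a * c) % n             ≡⟨ %-distribˡ-* a c n ⟩
    (a % n * (c % n)) % n   ≡⟨ cong₂ (λ s t → (s * t) % n) a≡b c≡e ⟩
    (b % n * (e % n)) % n   ≡⟨ %-distribˡ-* b e n ⟨
    (b * e) % n             ∎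
    where open ≡-Reasoning

  toℕ-mod : ∀ a → toℕ (a mod n) ≡ a % n
  toℕ-mod a = toℕ-fromℕ< (m%n<n a n)

  toℕ-mod-% : ∀ a → toℕ (a mod n) % n ≡ a % n
  toℕ-mod-% a = trans (%-congˡ (toℕ-mod a)) (m%n%n≡m%n a n)

  %≡toℕ⇒mod≡ : ∀ {a} {v : Fin n} → a % n ≡ toℕ v → a mod n ≡ v
  %≡toℕ⇒mod≡ {a} eq = toℕ-injective (trans (toℕ-mod a) eq)

  shift : Fin n → ℕ → Fin n
  shift x i = (toℕ x + i) mod n

  offset : Fin n → Fin n → ℕ
  offset x v = (toℕ v + (n ∸ toℕ x)) % n

  offset<n : ∀ x v → offset x v < n
  offset<n x v = m%n<n _ n

  +-offset : ∀ x v → (toℕ x + offset x v) % n ≡ toℕ v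
  +-offset x v = begin
    (toℕ x + offset x v) % n               ≡⟨ %-cong-+ {a = toℕ x} refl (m%n%n≡m%n _ n) ⟩
    (toℕ x + (toℕ v + (n ∸ toℕ x))) % n    ≡⟨ %-congˡ (exchange (toℕ x) (toℕ v) (n ∸ toℕ x)) ⟩
    (toℕ v + (toℕ x + (n ∸ toℕ x))) % n    ≡⟨ %-congˡ (cong (toℕ v +_) (m+[n∸m]≡n (<⇒≤ (toℕ<n x)))) ⟩
    (toℕ v + n) % n                        ≡⟨ [m+n]%n≡m%n (toℕ v) n ⟩
    toℕ v % n                              ≡⟨ m<n⇒m%n≡m (toℕ<n v) ⟩
    toℕ v                                  ∎
    where
    open ≡-Reasoning
    exchange : ∀ a b c → a + (b + c) ≡ b + (a + c)
    exchange = solve-∀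

  [d^m*x]%n≡[x+repunit*q]%n : ∀ d x q → (d * x) % n ≡ (x + q) % n →
    ∀ m → (d ^ m * x) % n ≡ (x + repunit d m * q) % n
  [d^m*x]%n≡[x+repunit*q]%n d x q dx≡x+q zero    = %-congˡ (trans (*-identityˡ x) (sym (+-identityʳ x)))
  [d^m*x]%n≡[x+repunit*q]%n d x q dx≡x+q (suc m) = begin
    (d * d ^ m * x) % n                    ≡⟨ %-congˡ (*-assoc d (d ^ m) x) ⟩
    (d * (d ^ m * x)) % n                  ≡⟨ %-cong-* {a = d} refl ([d^m*x]%n≡[x+repunit*q]%n d x q dx≡x+q m) ⟩
    (d * (x + R * q)) % n                  ≡⟨ %-congˡ (*-distribˡ-+ d x (R * q)) ⟩
    (d * x + d * (R * q)) % n              ≡⟨ %-cong-+ {c = d * (R * q)} dx≡x+q refl ⟩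
    (x + q + d * (R * q)) % n              ≡⟨ %-congˡ (regroup x q d R) ⟩
    (x + (1 + d * R) * q) % n              ∎
    where
    open ≡-Reasoning
    R = repunit d m
    regroup : ∀ x q d R → x + q + d * (R * q) ≡ x + (1 + d * R) * q
    regroup = solve-∀

∣p∪q∣≤∣p∣+∣q∣ : ∀ {n} (p q : Subset n) → ∣ p ∪ q ∣ ≤ ∣ p ∣ + ∣ q ∣
∣p∪q∣≤∣p∣+∣q∣ []            []            = z≤n
∣p∪q∣≤∣p∣+∣q∣ (inside ∷ p)  (s ∷ q)       =
  s≤s (≤-trans (∣p∪q∣≤∣p∣+∣q∣ p q) (+-monoʳ-≤ ∣ p ∣ (∣p∣≤∣x∷p∣ s q)))
∣p∪q∣≤∣p∣+∣q∣ (outside ∷ p) (inside ∷ q)  =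
  ≤-trans (s≤s (∣p∪q∣≤∣p∣+∣q∣ p q)) (≤-reflexive (sym (+-suc ∣ p ∣ ∣ q ∣)))
∣p∪q∣≤∣p∣+∣q∣ (outside ∷ p) (outside ∷ q) = ∣p∪q∣≤∣p∣+∣q∣ p q

fromList : ∀ {n} → List (Fin n) → Subset n
fromList L = ⋃ (map ⁅_⁆ L)

module _ {n : ℕ} where

  ∈-fromList⁺ : ∀ {v : Fin n} {L} → v ∈ₗ L → v ∈ fromList L
  ∈-fromList⁺ (lhere refl) = x∈p∪q⁺ (inj₁ (x∈⁅x⁆ _))
  ∈-fromList⁺ (lthere v∈L) = x∈p∪q⁺ (inj₂ (∈-fromList⁺ v∈L))

  ∈-fromList⁻ : ∀ {v : Fin n} L → v ∈ fromList L → v ∈ₗ L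
  ∈-fromList⁻ []      v∈ = ⊥-elim (∉⊥ v∈)
  ∈-fromList⁻ (u ∷ L) v∈ with x∈p∪q⁻ ⁅ u ⁆ (fromList L) v∈
  ... | inj₁ v∈⁅u⁆ = lhere (x∈⁅y⁆⇒x≡y u v∈⁅u⁆)
  ... | inj₂ v∈L   = lthere (∈-fromList⁻ L v∈L)

  ∣fromList∣≤length : ∀ (L : List (Fin n)) → ∣ fromList L ∣ ≤ length L
  ∣fromList∣≤length []      = ≤-reflexive (∣⊥∣≡0 n)
  ∣fromList∣≤length (u ∷ L) = ≤-trans (∣p∪q∣≤∣p∣+∣q∣ ⁅ u ⁆ (fromList L))
    (+-mono-≤ (≤-reflexive (∣⁅x⁆∣≡1 u)) (∣fromList∣≤length L))

  ∣p∣≤length : ∀ (p : Subset n) (L : List (Fin n)) → (∀ {v} → v ∈ p → v ∈ₗ L) → ∣ p ∣ ≤ length L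
  ∣p∣≤length p L p⊆L = ≤-trans (p⊆q⇒∣p∣≤∣q∣ (∈-fromList⁺ ∘ p⊆L)) (∣fromList∣≤length L)

members : ∀ {n} → Subset n → List (Fin n)
members []            = []
members (inside ∷ p)  = Fin.zero ∷ map Fin.suc (members p)
members (outside ∷ p) = map Fin.suc (members p)

length-members : ∀ {n} (p : Subset n) → length (members p) ≡ ∣ p ∣
length-members []            = refl
length-members (inside ∷ p)  = cong suc (trans (length-map Fin.suc (members p)) (length-members p))
length-members (outside ∷ p) = trans (length-map Fin.suc (members p)) (length-members p)

∈-members : ∀ {n} {v : Fin n} {p} → v ∈ p → v ∈ₗ members p
∈-members {p = inside ∷ p}  here       = lhere refl
∈-members {p = inside ∷ p}  (there v∈) = lthere (∈-map⁺ Fin.suc (∈-members v∈))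
∈-members {p = outside ∷ p} (there v∈) = ∈-map⁺ Fin.suc (∈-members v∈)

module _ {n : ℕ} .{{_ : NonZero n}} (x : Fin n) (q : ℕ) where

  open Modular n

  interval : Subset n
  interval = fromList (map (shift x) (upTo q))

  ∈-interval⁺ : ∀ {i} → i < q → shift x i ∈ interval
  ∈-interval⁺ i<q = ∈-fromList⁺ (∈-map⁺ (shift x) (∈-upTo⁺ i<q))

  ∈-interval⇔ : ∀ v → (v ∈ interval) ⇔ (∃[ i ] (i < q × (toℕ x + i) % n ≡ toℕ v))
  ∈-interval⇔ v = mk⇔ to from
    where
    to : v ∈ interval → ∃[ i ] (i < q × (toℕ x + i) % n ≡ toℕ v)
    to v∈ with ∈-map⁻ (shift x) (∈-fromList⁻ _ v∈)
    ... | i , i∈ , refl = i , ∈-upTo⁻ i∈ , sym (toℕ-mod _)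
    from : ∃[ i ] (i < q × (toℕ x + i) % n ≡ toℕ v) → v ∈ interval
    from (i , i<q , eq) = subst (_∈ interval) (%≡toℕ⇒mod≡ eq) (∈-interval⁺ i<q)

  ∣interval∣≤q : ∣ interval ∣ ≤ q
  ∣interval∣≤q = ≤-trans (∣fromList∣≤length (map (shift x) (upTo q)))
                         (≤-reflexive (trans (length-map (shift x) (upTo q)) (length-upTo q)))

module DeBruijn (n d : ℕ) .{{_ : NonZero n}} where

  open Modular n

  successor : Fin n → ℕ → Fin n
  successor u i = (d * toℕ u + i) mod n

  arc-successor : ∀ u {i} → i < d → Arc n d u (successor u i)
  arc-successor u {i} i<d = i , i<d , sym (toℕ-mod _)

  successors : Fin n → List (Fin n)
  successors u = map (successor u) (upTo d)

  length-successors : ∀ u → length (successors u) ≡ d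
  length-successors u = trans (length-map (successor u) (upTo d)) (length-upTo d)

  arc⇒∈successors : ∀ {u w} → Arc n d u w → w ∈ₗ successors u
  arc⇒∈successors {u} (i , i<d , eq) =
    subst (_∈ₗ successors u) (%≡toℕ⇒mod≡ eq) (∈-map⁺ (successor u) (∈-upTo⁺ i<d))

  -- Vertices within distance k of u, listed with repetitions so that the length is exactly geomSum d k.
  ball : ℕ → Fin n → List (Fin n)
  ball zero    u = u ∷ []
  ball (suc k) u = u ∷ concatMap (ball k) (successors u)

  length-ball : ∀ k u → length (ball k u) ≡ geomSum d k
  length-ball zero    u = refl
  length-ball (suc k) u = cong suc (trans (length-concatMap (ball k) (length-ball k) (successors u))
                                          (cong (_* geomSum d k) (length-successors u)))

  ∈-ball : ∀ {m k u v} → Walk n d m u v → m ≤ k → v ∈ₗ ball k u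
  ∈-ball {k = zero}  here _ = lhere refl
  ∈-ball {k = suc k} here _ = lhere refl
  ∈-ball {k = suc k} (step arc walk) (s≤s m≤k) =
    lthere (∈-concatMap⁺ (ball k) (lose (arc⇒∈successors arc) (∈-ball walk m≤k)))

  n≤∣D∣*geomSum : ∀ k (D : Subset n) → IsDistDom n d k D → n ≤ ∣ D ∣ * geomSum d k
  n≤∣D∣*geomSum k D dominating = begin
    n                                          ≡⟨ ∣⊤∣≡n n ⟨
    ∣ ⊤ {n} ∣                                  ≤⟨ ∣p∣≤length ⊤ balls covered ⟩
    length balls                               ≡⟨ length-concatMap (ball k) (length-ball k) (members D) ⟩
    length (members D) * geomSum d k           ≡⟨ cong (_* geomSum d k) (length-members D) ⟩
    ∣ D ∣ * geomSum d k                        ∎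
    where
    open ≤-Reasoning
    balls : List (Fin n)
    balls = concatMap (ball k) (members D)
    ∈-balls : ∀ {u m v} → u ∈ D → Walk n d m u v → m ≤ k → v ∈ₗ balls
    ∈-balls u∈D walk m≤k = ∈-concatMap⁺ (ball k) (lose (∈-members u∈D) (∈-ball walk m≤k))
    covered : ∀ {v} → v ∈ ⊤ → v ∈ₗ balls
    covered {v} _ with v ∈? D
    ... | yes v∈D = ∈-balls v∈D here z≤n
    ... | no v∉D  = let _ , u∈D , _ , m≤k , walk = dominating v v∉D in ∈-balls u∈D walk m≤k

  walk-to : .{{_ : NonZero d}} → ∀ m {u v : Fin n} i → i < d ^ m →
    (d ^ m * toℕ u + i) % n ≡ toℕ v → Walk n d m u v
  walk-to zero {u} {v} zero _ eq = subst (Walk n d 0 u) (toℕ-injective u≡v) here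
    where
    u≡v : toℕ u ≡ toℕ v
    u≡v = trans (sym (m<n⇒m%n≡m (toℕ<n u)))
                (trans (%-congˡ (sym (trans (+-identityʳ _) (*-identityˡ (toℕ u))))) eq)
  walk-to zero (suc i) (s≤s ()) _
  walk-to (suc m) {u} {v} i i<dᵐ⁺¹ eq =
    step (arc-successor u (m<n*o⇒m/o<n i<dᵐ⁺¹)) (walk-to m (i % e) (m%n<n i e) eq′)
    where
    e = d ^ m
    instance
      e≢0 : NonZero e
      e≢0 = m^n≢0 d m
    w : Fin n
    w = successor u (i / e)
    rearrange : ∀ e d u a b → e * (d * u + a) + b ≡ d * e * u + (b + a * e)
    rearrange = solve-∀
    eq′ : (e * toℕ w + i % e) % n ≡ toℕ v
    eq′ = begin
      (e * toℕ w + i % e) % n                ≡⟨ %-cong-+ {c = i % e} (%-cong-* {a = e} refl (toℕ-mod-% _)) refl ⟩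
      (e * (d * toℕ u + i / e) + i % e) % n  ≡⟨ %-congˡ (rearrange e d (toℕ u) (i / e) (i % e)) ⟩
      (d * e * toℕ u + (i % e + i / e * e)) % n ≡⟨ %-congˡ (cong (d * e * toℕ u +_) (m≡m%n+[m/n]*n i e)) ⟨
      (d * e * toℕ u + i) % n                ≡⟨ eq ⟩
      toℕ v                                  ∎
      where open ≡-Reasoning

  shift-walk : .{{_ : NonZero d}} → ∀ q (x v : Fin n) → (d * toℕ x) % n ≡ (toℕ x + q) % n →
    ∀ m j {i} → i < d ^ m → repunit d m * q + (d ^ m * j + i) ≡ offset x v → Walk n d m (shift x j) v
  shift-walk q x v dx≡x+q m j {i} i<dᵐ ≡offset = walk-to m i i<dᵐ (begin
    (e * toℕ (shift x j) + i) % n          ≡⟨ %-cong-+ {c = i} (%-cong-* {a = e} refl (toℕ-mod-% _)) refl ⟩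
    (e * (toℕ x + j) + i) % n              ≡⟨ %-congˡ (rearrange e (toℕ x) j i) ⟩
    (e * toℕ x + (e * j + i)) % n          ≡⟨ %-cong-+ {c = e * j + i} ([d^m*x]%n≡[x+repunit*q]%n d (toℕ x) q dx≡x+q m) refl ⟩
    (toℕ x + repunit d m * q + (e * j + i)) % n
                                           ≡⟨ %-congˡ (trans (+-assoc (toℕ x) _ _) (cong (toℕ x +_) ≡offset)) ⟩
    (toℕ x + offset x v) % n               ≡⟨ +-offset x v ⟩
    toℕ v                                  ∎)
    where
    open ≡-Reasoning
    e = d ^ m
    rearrange : ∀ e x j i → e * (x + j) + i ≡ e * x + (e * j + i)
    rearrange = solve-∀

  interval-dominates : .{{_ : NonZero d}} → ∀ k q (x : Fin n) → n ≡ geomSum d k * q →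
    (d * toℕ x) % n ≡ (toℕ x + q) % n → IsDistDom n d k (interval x q)
  interval-dominates k q x n≡Sq dx≡x+q v _
    with repunit-decomposition d q k
           (subst (offset x v <_) (trans n≡Sq (cong (_* q) (geomSum≡repunit d k))) (offset<n x v))
  ... | m , m≤k , j , j<q , i , i<dᵐ , ≡offset =
    shift x j , ∈-interval⁺ x q j<q ,
    m , m≤k , shift-walk q x v dx≡x+q m j i<dᵐ ≡offset

corollary2p2 : (n d k : ℕ) → .{{_ : NonZero n}} →
    2 ≤ d → d ≤ n → 1 ≤ k → geomSum d k ∣ n →
    (x : Fin n) → ((d ∸ 1) * toℕ x) % n ≡ (quot n d k) % n →
    ∃[ D ] (((v : Fin n) → ((v ∈ D) ⇔ (∃[ i ] (i < quot n d k × (toℕ x + i) % n ≡ toℕ v))))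
    × IsDistDom n d k D
    × ∣ D ∣ ≡ quot n d k
    × ((D' : Subset n) → IsDistDom n d k D' → ∣ D ∣ ≤ ∣ D' ∣))
-- For d = suc d-1 the product
-- d * x reduces to x + d-1 * x, which turns (d - 1) x ≡ q into d x ≡ x + q.
corollary2p2 n zero k () _ _ _ _ _
corollary2p2 n d@(suc d-1) k _ _ _ S∣n x d-1*x≡q =
  interval x q , ∈-interval⇔ x q , dominating ,
  ≤-antisym (∣interval∣≤q x q) (q≤∣D∣ _ dominating) ,
  λ D' dominating′ → ≤-trans (∣interval∣≤q x q) (q≤∣D∣ D' dominating′)
  where
  open Modular n
  open DeBruijn n d
  S = geomSum d k
  q = quot n d k
  instance
    S≢0 : NonZero S
    S≢0 = geomSum-nonZero d k
  n≡Sq : n ≡ S * q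
  n≡Sq = sym (m*[n/m]≡n S∣n)
  dominating : IsDistDom n d k (interval x q)
  dominating = interval-dominates k q x n≡Sq (%-cong-+ {a = toℕ x} refl d-1*x≡q)
  q≤∣D∣ : ∀ D → IsDistDom n d k D → q ≤ ∣ D ∣
  q≤∣D∣ D dom = *-cancelʳ-≤ q ∣ D ∣ S (subst (_≤ ∣ D ∣ * S) (trans n≡Sq (*-comm S q)) (n≤∣D∣*geomSum k D dom))
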